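{- Let $\mathcal{CS}$ be any constant specification. $\mathsf{LP}^{\mathsf{C}}_h(\mathcal{CS})$ has the finite model property with respect to AF-models: for every formula $A$, if $\not\vdash_{\mathcal{CS}}A$, then there is an AF-model $\mathcal{M}=(W,R,\mathcal{E},\nu)$ meeting $\mathcal{CS}$ with $W$ finite and a world $w\in W$ such that $\mathcal{M},w\not\Vdash A$.
   Context: Fix a number $h\ge 1$ of agents. Throughout, $i$ ranges over $\{1,\dots,h\}$, $*$ over $\{1,\dots,h,\mathsf{C}\}$, and $\circledast$ over $\{1,\dots,h,\mathsf{E},\mathsf{C}\}$. For each $\circledast$ let $\mathrm{Cons}_\circledast$ (proof constants) and $\mathrm{Var}_\circledast$ (proof variables) be countably infinite sets, all pairwise disjoint. Evidence terms $\mathrm{Tm}_1,\dots,\mathrm{Tm}_h,\mathrm{Tm}_{\mathsf{E}},\mathrm{Tm}_{\mathsf{C}}$ are defined by simultaneous induction: $\mathrm{Cons}_\circledast\cup\mathrm{Var}_\circledast\subseteq\mathrm{Tm}_\circledast$; if $t\in\mathrm{Tm}_i$ then $!_i t\in\mathrm{Tm}_i$; if $t,s\in\mathrm{Tm}_*$ then $t+_*s,\ t\cdot_* s\in\mathrm{Tm}_*$; if $t_1\in\mathrm{Tm}_1,\dots,t_h\in\mathrm{Tm}_h$ then $\langle t_1,\dots,t_h\rangle\in\mathrm{Tm}_{\mathsf{E}}$; if $t\in\mathrm{Tm}_{\mathsf{E}}$ then $\pi_i t\in\mathrm{Tm}_i$; if $t\in\mathrm{Tm}_{\mathsf{C}}$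 then $\mathsf{hd}(t),\mathsf{tl}(t)\in\mathrm{Tm}_{\mathsf{E}}$; if $t\in\mathrm{Tm}_{\mathsf{C}}$ and $s\in\mathrm{Tm}_{\mathsf{E}}$ then $\mathsf{ind}(t,s)\in\mathrm{Tm}_{\mathsf{C}}$. $\mathrm{Tm}$ is the union of all these sets. Formulae are built from a countable set $\mathrm{Prop}$ of propositional variables using $\neg,\wedge,\vee,\to$ and the rule: if $A$ is a formula and $t\in\mathrm{Tm}_\circledast$ then $t{:}_\circledast A$ is a formula (indices on $!,+,\cdot$ omitted when clear). Axioms of $\mathsf{LP}^{\mathsf{C}}_h$ (all instances): (1) propositional tautologies; (2) $t{:}_*(A\to B)\to(s{:}_*A\to (t\cdot s){:}_*B)$; (3) $t{:}_*A\to(t+s){:}_*A$ and $s{:}_*A\to(t+s){:}_*A$; (4) $t{:}_iA\to A$; (5) $t{:}_iA\to (!t){:}_i\, t{:}_iA$; (6) $t_1{:}_1A\wedge\dots\wedge t_h{:}_hA\to\langle t_1,\dots,t_h\rangle{:}_{\mathsf{E}}A$; (7) $t{:}_{\mathsf{E}}A\to (\pi_it){:}_iA$; (8) $t{:}_{\mathsf{C}}A\to\mathsf{hd}(t){:}_{\mathsf{E}}A$ and $t{:}_{\mathsf{C}}A\to\mathsf{tl}(t){:}_{\mathsf{E}}\,t{:}_{\mathsf{C}}A$; (9) $A\wedge t{:}_{\mathsf{C}}(A\to s{:}_{\mathsf{E}}A)\to\mathsf{ind}(t,s){:}_{\mathsf{C}}A$. A constant specification $\mathcal{CS}$ is any set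 of formulae $c{:}_\circledast A$ with $c\in\mathrm{Cons}_\circledast$ and $A$ an axiom. $\mathsf{LP}^{\mathsf{C}}_h(\mathcal{CS})$ is the Hilbert system with these axioms, modus ponens, and axiom necessitation (derive $c{:}_\circledast A$ whenever $c{:}_\circledast A\in\mathcal{CS}$); $\vdash_{\mathcal{CS}}A$ means $A$ is derivable in it. AF-models: an AF-model meeting $\mathcal{CS}$ is $\mathcal{M}=(W,R,\mathcal{E},\nu)$ with $W\neq\emptyset$, reflexive transitive relations $R_1,\dots,R_h$ on $W$, $\nu:\mathrm{Prop}\to\mathcal{P}(W)$, $R_{\mathsf{E}}:=R_1\cup\dots\cup R_h$, $R_{\mathsf{C}}:=\bigcup_{n\ge1}(R_{\mathsf{E}})^n$, and an evidence function $\mathcal{E}:W\times\mathrm{Tm}\to\mathcal{P}(\text{formulae})$, writing $\mathcal{E}_\circledast$ for its restriction to $W\times\mathrm{Tm}_\circledast$, such that for all $w,v\in W$: (monotonicity) $\mathcal{E}_*(w,t)\subseteq\mathcal{E}_*(v,t)$ whenever $(w,v)\in R_*$; (constant specification) $c{:}_\circledast A\in\mathcal{CS}$ implies $A\in\mathcal{E}_\circledast(w,c)$; (application) $A\to B\in\mathcal{E}_*(w,t)$ and $A\in\mathcal{E}_*(w,s)$ imply $B\in\mathcal{E}_*(w,t\cdot s)$; (sum) $\mathcal{E}_*(w,s)\cup\mathcal{E}_*(w,t)\subseteq\mathcal{E}_*(w,s+t)$; (inspection) $A\in\mathcal{E}_i(w,t)$ implies $t{:}_iA\in\mathcal{E}_i(w,!t)$;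 (tupling) $A\in\mathcal{E}_i(w,t_i)$ for all $i$ implies $A\in\mathcal{E}_{\mathsf{E}}(w,\langle t_1,\dots,t_h\rangle)$; (projection) $A\in\mathcal{E}_{\mathsf{E}}(w,t)$ implies $A\in\mathcal{E}_i(w,\pi_it)$; (co-closure) $A\in\mathcal{E}_{\mathsf{C}}(w,t)$ implies $A\in\mathcal{E}_{\mathsf{E}}(w,\mathsf{hd}(t))$ and $t{:}_{\mathsf{C}}A\in\mathcal{E}_{\mathsf{E}}(w,\mathsf{tl}(t))$; (induction) $A\in\mathcal{E}_{\mathsf{E}}(w,s)$ and $A\to s{:}_{\mathsf{E}}A\in\mathcal{E}_{\mathsf{C}}(w,t)$ imply $A\in\mathcal{E}_{\mathsf{C}}(w,\mathsf{ind}(t,s))$. Satisfaction: $\mathcal{M},w\Vdash P$ iff $w\in\nu(P)$; classical for connectives; $\mathcal{M},w\Vdash t{:}_\circledast A$ iff $A\in\mathcal{E}_\circledast(w,t)$ and $\mathcal{M},v\Vdash A$ for all $v$ with $(w,v)\in R_\circledast$. -}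

module Defs where

open import Data.Nat using (ℕ)
open import Data.Fin using (Fin)
open import Data.List using (List; []; _∷_; map; allFin)
open import Data.Bool using (Bool; true; false; not; _∧_; _∨_)
open import Data.Product using (Σ; ∃; _×_; _,_)
open import Data.Sum using (_⊎_)
open import Data.Empty using (⊥)
open import Relation.Nullary using (¬_)
open import Relation.Binary.PropositionalEquality using (_≡_)
open import Relation.Binary.Construct.Closure.Transitive using (TransClosure)

data Sort (h : ℕ) : Set where
  ag : Fin h → Sort h
  E  : Sort h
  C  : Sort h

data Star {h : ℕ} : Sort h → Set where
  star-ag : (i : Fin h) → Star (ag i)
  star-C  : Star C

-- Evidence terms.  Constants and variables of each sort are indexed
-- by ℕ (countably infinite, pairwise disjoint since tagged by sort and
-- by constructor).

data Tm (h : ℕ) : Sort h → Set where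
  cons  : {s : Sort h} → ℕ → Tm h s
  var   : {s : Sort h} → ℕ → Tm h s
  !_    : {i : Fin h} → Tm h (ag i) → Tm h (ag i)
  plusA : {i : Fin h} → Tm h (ag i) → Tm h (ag i) → Tm h (ag i)
  appA  : {i : Fin h} → Tm h (ag i) → Tm h (ag i) → Tm h (ag i)
  plusC : Tm h C → Tm h C → Tm h C
  appC  : Tm h C → Tm h C → Tm h C
  tup   : ((i : Fin h) → Tm h (ag i)) → Tm h E
  proj  : (i : Fin h) → Tm h E → Tm h (ag i)
  hd    : Tm h C → Tm h E
  tl    : Tm h C → Tm h E
  ind   : Tm h C → Tm h E → Tm h C

plus : {h : ℕ} {s : Sort h} → Star s → Tm h s → Tm h s → Tm h s
plus (star-ag i) = plusA
plus star-C      = plusC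

app : {h : ℕ} {s : Sort h} → Star s → Tm h s → Tm h s → Tm h s
app (star-ag i) = appA
app star-C      = appC

infixr 5 _⇒_
data Fm (h : ℕ) : Set where
  atom : ℕ → Fm h
  neg  : Fm h → Fm h
  _∧'_ : Fm h → Fm h → Fm h
  _∨'_ : Fm h → Fm h → Fm h
  _⇒_  : Fm h → Fm h → Fm h
  jst  : {s : Sort h} → Tm h s → Fm h → Fm h

-- Propositional tautologies: true under every Boolean valuation that
-- treats propositional variables and justification formulas t:A as atoms.

eval : {h : ℕ} → (ℕ → Bool) → ({s : Sort h} → Tm h s → Fm h → Bool) → Fm h → Bool
eval v vj (atom p)  = v p
eval v vj (neg A)   = not (eval v vj A)
eval v vj (A ∧' B)  = eval v vj A ∧ eval v vj B
eval v vj (A ∨' B)  = eval v vj A ∨ eval v vj B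
eval v vj (A ⇒ B)   = not (eval v vj A) ∨ eval v vj B
eval v vj (jst t A) = vj t A

Tautology : {h : ℕ} → Fm h → Set
Tautology {h} A = (v : ℕ → Bool) (vj : {s : Sort h} → Tm h s → Fm h → Bool) → eval v vj A ≡ true

-- Conjunction of a list of formulae: [A1,…,An] ↦ A1 ∧ (A2 ∧ (… ∧ An)).
-- (The empty case is never used, since h ≥ 1; it is set to ¬(p0 ∧ ¬p0).)
conj : {h : ℕ} → List (Fm h) → Fm h
conj []           = neg (atom 0 ∧' neg (atom 0))
conj (A ∷ [])     = A
conj (A ∷ B ∷ Bs) = A ∧' conj (B ∷ Bs)

bigAnd : {h : ℕ} → ((i : Fin h) → Tm h (ag i)) → Fm h → Fm h
bigAnd {h} ts A = conj (map (λ i → jst (ts i) A) (allFin h))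

data Axiom {h : ℕ} : Fm h → Set where
  ax1 : {A : Fm h} → Tautology A → Axiom A
  ax2 : {s : Sort h} (st : Star s) (t u : Tm h s) (A B : Fm h) →
        Axiom (jst t (A ⇒ B) ⇒ (jst u A ⇒ jst (app st t u) B))
  ax3l : {s : Sort h} (st : Star s) (t u : Tm h s) (A : Fm h) →
        Axiom (jst t A ⇒ jst (plus st t u) A)
  ax3r : {s : Sort h} (st : Star s) (t u : Tm h s) (A : Fm h) →
        Axiom (jst u A ⇒ jst (plus st t u) A)
  ax4 : {i : Fin h} (t : Tm h (ag i)) (A : Fm h) → Axiom (jst t A ⇒ A)
  ax5 : {i : Fin h} (t : Tm h (ag i)) (A : Fm h) → Axiom (jst t A ⇒ jst (! t) (jst t A))
  ax6 : (ts : (i : Fin h) → Tm h (ag i)) (A : Fm h) →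
        Axiom (bigAnd ts A ⇒ jst (tup ts) A)
  ax7 : (i : Fin h) (t : Tm h E) (A : Fm h) → Axiom (jst t A ⇒ jst (proj i t) A)
  ax8hd : (t : Tm h C) (A : Fm h) → Axiom (jst t A ⇒ jst (hd t) A)
  ax8tl : (t : Tm h C) (A : Fm h) → Axiom (jst t A ⇒ jst (tl t) (jst t A))
  ax9 : (t : Tm h C) (u : Tm h E) (A : Fm h) →
        Axiom ((A ∧' jst t (A ⇒ jst u A)) ⇒ jst (ind t u) A)

-- CS s c A  means  c:_s A ∈ CS  (c ∈ Cons_s)
ConstSpec : ℕ → Set₁
ConstSpec h = Sort h → ℕ → Fm h → Set

IsConstSpec : {h : ℕ} → ConstSpec h → Set
IsConstSpec {h} CS = (s : Sort h) (c : ℕ) (A : Fm h) → CS s c A → Axiom A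

data Prf {h : ℕ} (CS : ConstSpec h) : Fm h → Set where
  ax  : {A : Fm h} → Axiom A → Prf CS A
  mp  : {A B : Fm h} → Prf CS (A ⇒ B) → Prf CS A → Prf CS B
  nec : {s : Sort h} {c : ℕ} {A : Fm h} → CS s c A → Prf CS (jst (cons {s = s} c) A)

RelE : {h : ℕ} {W : Set} → (Fin h → W → W → Set) → W → W → Set
RelE {h} R w v = Σ (Fin h) λ i → R i w v

RelC : {h : ℕ} {W : Set} → (Fin h → W → W → Set) → W → W → Set
RelC R = TransClosure (RelE R)

RelOf : {h : ℕ} {W : Set} → (Fin h → W → W → Set) → Sort h → W → W → Set
RelOf R (ag i) = R i
RelOf R E      = RelE R
RelOf R C      = RelC R

record AFModel {h : ℕ} (CS : ConstSpec h) (W : Set) : Set₁ where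
  field
    R      : Fin h → W → W → Set
    R-refl : (i : Fin h) (w : W) → R i w w
    R-trans : (i : Fin h) {u v w : W} → R i u v → R i v w → R i u w
    ν      : ℕ → W → Set
    Ev     : W → {s : Sort h} → Tm h s → Fm h → Set   -- A ∈ 𝓔_s(w,t)

  RS : Sort h → W → W → Set
  RS = RelOf R

  field
    monotone : {s : Sort h} → Star s → {w v : W} (t : Tm h s) (A : Fm h) →
               RS s w v → Ev w t A → Ev v t A
    constSpec : (w : W) {s : Sort h} (c : ℕ) (A : Fm h) → CS s c A → Ev w (cons {s = s} c) A
    application : (w : W) {s : Sort h} (st : Star s) (t u : Tm h s) (A B : Fm h) →
               Ev w t (A ⇒ B) → Ev w u A → Ev w (app st t u) B
    sumˡ : (w : W) {s : Sort h} (st : Star s) (t u : Tm h s) (A : Fm h) →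
               Ev w u A → Ev w (plus st u t) A
    sumʳ : (w : W) {s : Sort h} (st : Star s) (t u : Tm h s) (A : Fm h) →
               Ev w t A → Ev w (plus st u t) A
    inspection : (w : W) {i : Fin h} (t : Tm h (ag i)) (A : Fm h) →
               Ev w t A → Ev w (! t) (jst t A)
    tupling : (w : W) (ts : (i : Fin h) → Tm h (ag i)) (A : Fm h) →
               ((i : Fin h) → Ev w (ts i) A) → Ev w (tup ts) A
    projection : (w : W) (i : Fin h) (t : Tm h E) (A : Fm h) →
               Ev w t A → Ev w (proj i t) A
    coclosure-hd : (w : W) (t : Tm h C) (A : Fm h) → Ev w t A → Ev w (hd t) A
    coclosure-tl : (w : W) (t : Tm h C) (A : Fm h) → Ev w t A → Ev w (tl t) (jst t A)
    induction : (w : W) (t : Tm h C) (u : Tm h E) (A : Fm h) →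
               Ev w u A → Ev w t (A ⇒ jst u A) → Ev w (ind t u) A

  _⊩_ : W → Fm h → Set
  w ⊩ atom p  = ν p w
  w ⊩ neg A   = ¬ (w ⊩ A)
  w ⊩ (A ∧' B) = (w ⊩ A) × (w ⊩ B)
  w ⊩ (A ∨' B) = (w ⊩ A) ⊎ (w ⊩ B)
  w ⊩ (A ⇒ B) = (w ⊩ A) → (w ⊩ B)
  w ⊩ jst {s} t A = Ev w t A × ((v : W) → RS s w v → v ⊩ A)

-- Extend ¬A, by excluded middle, to a consistent finite set Δ that decides every
-- subformula of ¬A, and take the one-world model whose relations are total and
-- whose evidence is "Δ proves t:B". All evidence closure conditions are axioms
-- of LP^C_h, and every evidence sort is factive (C via hd, E via a projection to
-- an agent, which exists as h ≥ 1), so the truth lemma holds on subformulas of ¬A;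
-- hence ¬A is true at the only world.
module Submission where

open import Defs
open import Axiom.ExcludedMiddle using (ExcludedMiddle)
open import Data.Bool using (Bool; true; false; not; _∧_; _∨_)
open import Data.Bool.Properties using (∧-conicalˡ; ∧-conicalʳ; ∧-inverseʳ; ∨-zeroʳ)
open import Data.Empty using (⊥; ⊥-elim)
open import Data.Fin using (Fin; zero)
open import Data.List using (List; []; _∷_; _++_; allFin)
open import Data.List.Membership.Propositional using (_∈_)
open import Data.List.Membership.Propositional.Properties using (∈-++⁺ˡ; ∈-++⁺ʳ)
open import Data.List.Relation.Binary.Subset.Propositional using (_⊆_)
open import Data.List.Relation.Unary.All as All using (All; []; _∷_; lookup; universal)
open import Data.List.Relation.Unary.All.Properties using (map⁺; map⁻)
open import Data.List.Relation.Unary.Any using (here; there)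
open import Data.Nat using (ℕ; suc; _≤_; s≤s; z≤n)
open import Data.Product using (Σ; _,_)
open import Data.Sum as Sum using (_⊎_; inj₁; inj₂)
open import Data.Unit using (⊤; tt)
open import Function using (id)
open import Level using (0ℓ)
open import Relation.Binary.PropositionalEquality using (_≡_; refl; cong; cong₂; trans)
open import Relation.Nullary using (¬_; yes; no)

subformulas : {h : ℕ} → Fm h → List (Fm h)
subformulas (atom p)  = atom p ∷ []
subformulas (neg A)   = neg A ∷ subformulas A
subformulas (A ∧' B)  = (A ∧' B) ∷ subformulas A ++ subformulas B
subformulas (A ∨' B)  = (A ∨' B) ∷ subformulas A ++ subformulas B
subformulas (A ⇒ B)   = (A ⇒ B) ∷ subformulas A ++ subformulas B
subformulas (jst t A) = jst t A ∷ subformulas A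

∈-subformulas : {h : ℕ} (A : Fm h) → A ∈ subformulas A
∈-subformulas (atom p)  = here refl
∈-subformulas (neg A)   = here refl
∈-subformulas (A ∧' B)  = here refl
∈-subformulas (A ∨' B)  = here refl
∈-subformulas (A ⇒ B)   = here refl
∈-subformulas (jst t A) = here refl

modus-ponensᵇ : ∀ x {y} → not x ∨ y ≡ true → x ≡ true → y ≡ true
modus-ponensᵇ true e refl = e

disjunctive-syllogismᵇ : ∀ x {y} → x ∨ y ≡ true → not x ≡ true → y ≡ true
disjunctive-syllogismᵇ false e _ = e

non-contradictionᵇ : ∀ x → x ≡ true → not x ≡ true → ⊥
non-contradictionᵇ true refl ()

casesᵇ : ∀ x {y} → not x ∨ y ≡ true → not (not x) ∨ y ≡ true → y ≡ true
casesᵇ true  e _ = e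
casesᵇ false _ e = e

reductio-ad-absurdumᵇ : ∀ x y → not (not x) ∨ (y ∧ not y) ≡ true → x ≡ true
reductio-ad-absurdumᵇ true  _     _  = refl
reductio-ad-absurdumᵇ false true  ()
reductio-ad-absurdumᵇ false false ()

module Derivations {h : ℕ} (CS : ConstSpec h) where

  Valuation : Set
  Valuation = ℕ → Bool

  JustificationValuation : Set
  JustificationValuation = {s : Sort h} → Tm h s → Fm h → Bool

  AllTrue : Valuation → JustificationValuation → List (Fm h) → Set
  AllTrue v vj = All (λ P → eval v vj P ≡ true)

  infix 4 _⊨_ _⊢_

  _⊨_ : List (Fm h) → Fm h → Set
  Ps ⊨ Q = (v : Valuation) (vj : JustificationValuation) →
           AllTrue v vj Ps → eval v vj Q ≡ true

  variable
    Γ Γ₀ Ps S : List (Fm h)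
    P Q X Y : Fm h

  prf-tautological : All (Prf CS) Ps → Ps ⊨ Q → Prf CS Q
  prf-tautological []                        f = ax (ax1 (λ v vj → f v vj []))
  prf-tautological {P ∷ _} {Q} (p ∷ ps) f = mp (prf-tautological ps f⇒) p
    where
    f⇒ : _ ⊨ P ⇒ Q
    f⇒ v vj es with eval v vj P in eq
    ... | true  = f v vj (eq ∷ es)
    ... | false = refl

  _⇒*_ : List (Fm h) → Fm h → Fm h
  []      ⇒* X = X
  (D ∷ Γ) ⇒* X = D ⇒ (Γ ⇒* X)

  -- Γ ⊢ X means that Γ ⇒* X is derivable, so the deduction theorem holds by
  -- definition; it is a record only so that Γ and X can be inferred from Γ ⊢ X.
  record _⊢_ (Γ : List (Fm h)) (X : Fm h) : Set where
    constructor from-discharged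
    field discharge : Prf CS (Γ ⇒* X)

  open _⊢_

  eval-⇒*-elim : {v : Valuation} {vj : JustificationValuation} (Γ : List (Fm h)) →
                  eval v vj (Γ ⇒* X) ≡ true → AllTrue v vj Γ → eval v vj X ≡ true
  eval-⇒*-elim []      e []       = e
  eval-⇒*-elim (D ∷ Γ) e (d ∷ ds) = eval-⇒*-elim Γ (modus-ponensᵇ _ e d) ds

  eval-⇒*-intro : {v : Valuation} {vj : JustificationValuation} (Γ : List (Fm h)) →
                   (AllTrue v vj Γ → eval v vj X ≡ true) → eval v vj (Γ ⇒* X) ≡ true
  eval-⇒*-intro []          f = f []
  eval-⇒*-intro {v = v} {vj} (D ∷ Γ) f with eval v vj D in eq
  ... | true  = eval-⇒*-intro Γ (λ ds → f (eq ∷ ds))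
  ... | false = refl

  ⊢-tautological : All (Γ ⊢_) Ps → Ps ⊨ Q → Γ ⊢ Q
  ⊢-tautological {Γ} ps f = from-discharged
    (prf-tautological (map⁺ (All.map discharge ps)) λ v vj es →
       eval-⇒*-intro Γ λ ds → f v vj (All.map (λ e → eval-⇒*-elim Γ e ds) (map⁻ es)))

  ⊢-lift : Prf CS X → Γ ⊢ X
  ⊢-lift {Γ = Γ} p = from-discharged
    (prf-tautological (p ∷ []) λ { v vj (e ∷ []) → eval-⇒*-intro Γ λ _ → e })

  ⊢-member : X ∈ Γ → Γ ⊢ X
  ⊢-member {Γ = Γ} m = from-discharged
    (prf-tautological [] λ v vj _ → eval-⇒*-intro Γ λ ds → lookup ds m)

  ⊢-mp : Γ ⊢ X ⇒ Y → Γ ⊢ X → Γ ⊢ Y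
  ⊢-mp p q = ⊢-tautological (p ∷ q ∷ []) λ { v vj (e₁ ∷ e₂ ∷ []) → modus-ponensᵇ _ e₁ e₂ }

  ⊢-axiom : Axiom (X ⇒ Y) → Γ ⊢ X → Γ ⊢ Y
  ⊢-axiom a = ⊢-mp (⊢-lift (ax a))

  ⊢-∧-intro : Γ ⊢ X → Γ ⊢ Y → Γ ⊢ X ∧' Y
  ⊢-∧-intro p q = ⊢-tautological (p ∷ q ∷ []) λ { v vj (e₁ ∷ e₂ ∷ []) → cong₂ _∧_ e₁ e₂ }

  ⊢-∧-elimˡ : Γ ⊢ X ∧' Y → Γ ⊢ X
  ⊢-∧-elimˡ p = ⊢-tautological (p ∷ []) λ { v vj (e ∷ []) → ∧-conicalˡ _ _ e }

  ⊢-∧-elimʳ : Γ ⊢ X ∧' Y → Γ ⊢ Y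
  ⊢-∧-elimʳ p = ⊢-tautological (p ∷ []) λ { v vj (e ∷ []) → ∧-conicalʳ _ _ e }

  ⊢-∨-introˡ : Γ ⊢ X → Γ ⊢ X ∨' Y
  ⊢-∨-introˡ p = ⊢-tautological (p ∷ []) λ { v vj (e ∷ []) → cong (_∨ _) e }

  ⊢-∨-introʳ : Γ ⊢ Y → Γ ⊢ X ∨' Y
  ⊢-∨-introʳ p = ⊢-tautological (p ∷ []) λ { v vj (e ∷ []) → trans (cong (_ ∨_) e) (∨-zeroʳ _) }

  ⊢-disjunctive-syllogism : Γ ⊢ X ∨' Y → Γ ⊢ neg X → Γ ⊢ Y
  ⊢-disjunctive-syllogism p q =
    ⊢-tautological (p ∷ q ∷ [])
      λ { v vj (e₁ ∷ e₂ ∷ []) → disjunctive-syllogismᵇ _ e₁ e₂ }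

  ⊢-⇒-weaken : Γ ⊢ Y → Γ ⊢ X ⇒ Y
  ⊢-⇒-weaken p = ⊢-tautological (p ∷ []) λ { v vj (e ∷ []) → trans (cong (_ ∨_) e) (∨-zeroʳ _) }

  ⊢-⇒-vacuous : Γ ⊢ neg X → Γ ⊢ X ⇒ Y
  ⊢-⇒-vacuous p = ⊢-tautological (p ∷ []) λ { v vj (e ∷ []) → cong (_∨ _) e }

  ⊢-contradiction : Γ ⊢ X → Γ ⊢ neg X → Γ ⊢ Y
  ⊢-contradiction p q =
    ⊢-tautological (p ∷ q ∷ [])
      λ { v vj (e₁ ∷ e₂ ∷ []) → ⊥-elim (non-contradictionᵇ _ e₁ e₂) }

  ⊢-cases : X ∷ Γ ⊢ Y → neg X ∷ Γ ⊢ Y → Γ ⊢ Y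
  ⊢-cases p q = from-discharged (prf-tautological (discharge p ∷ discharge q ∷ [])
    λ { v vj (e₁ ∷ e₂ ∷ []) → casesᵇ _ e₁ e₂ })

  ⊢-conj : All (Γ ⊢_) Ps → Γ ⊢ conj Ps
  ⊢-conj []           = ⊢-tautological [] λ v vj _ → cong not (∧-inverseʳ (v 0))
  ⊢-conj (p ∷ [])     = p
  ⊢-conj (p ∷ q ∷ ps) = ⊢-∧-intro p (⊢-conj (q ∷ ps))

  ⊢-bigAnd : (ts : (i : Fin h) → Tm h (ag i)) → (∀ i → Γ ⊢ jst (ts i) X) → Γ ⊢ bigAnd ts X
  ⊢-bigAnd ts ps = ⊢-conj (map⁺ (universal ps (allFin h)))

  ⊢-factive : Fin h → {s : Sort h} {t : Tm h s} → Γ ⊢ jst t X → Γ ⊢ X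
  ⊢-factive i {ag j} {t} p = ⊢-axiom (ax4 t _) p
  ⊢-factive i {E}    {t} p = ⊢-axiom (ax4 (proj i t) _) (⊢-axiom (ax7 i t _) p)
  ⊢-factive i {C}    {t} p = ⊢-factive i (⊢-axiom (ax8hd t _) p)

  falsum : Fm h
  falsum = atom 0 ∧' neg (atom 0)

  Consistent : List (Fm h) → Set
  Consistent Γ = ¬ (Γ ⊢ falsum)

  consistent-neg : ¬ Prf CS X → Consistent (neg X ∷ [])
  consistent-neg ⊬X p =
    ⊬X (prf-tautological (discharge p ∷ [])
          λ { v vj (e ∷ []) → reductio-ad-absurdumᵇ _ (v 0) e })

  consistent-with-either : ExcludedMiddle 0ℓ → Consistent Γ → (X : Fm h) →
                           Consistent (X ∷ Γ) ⊎ Consistent (neg X ∷ Γ)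
  consistent-with-either {Γ} em con X with em {Consistent (X ∷ Γ)}
  ... | yes con⁺ = inj₁ con⁺
  ... | no ¬con⁺ = inj₂ λ q → ¬con⁺ λ p → con (⊢-cases p q)

  record Completion (Γ₀ S : List (Fm h)) : Set where
    field
      Δ          : List (Fm h)
      consistent : Consistent Δ
      extends    : Γ₀ ⊆ Δ
      decides    : ∀ {X} → X ∈ S → X ∈ Δ ⊎ neg X ∈ Δ

  open Completion

  adjoin : (c : Completion Γ₀ S) → Consistent (Y ∷ Δ c) →
           X ∈ Y ∷ Δ c ⊎ neg X ∈ Y ∷ Δ c → Completion Γ₀ (X ∷ S)
  adjoin {Y = Y} c con decidesX = record
    { Δ          = Y ∷ Δ c
    ; consistent = con
    ; extends    = λ m → there (extends c m)
    ; decides    = λ { (here refl) → decidesX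
                     ; (there m)   → Sum.map there there (decides c m) }
    }

  completion : ExcludedMiddle 0ℓ → Consistent Γ₀ → (S : List (Fm h)) → Completion Γ₀ S
  completion {Γ₀} em con [] =
    record { Δ = Γ₀ ; consistent = con ; extends = id ; decides = λ () }
  completion em con (X ∷ S) with completion em con S
  ... | c with consistent-with-either em (consistent c) X
  ...   | inj₁ con⁺ = adjoin c con⁺ (inj₁ (here refl))
  ...   | inj₂ con⁻ = adjoin c con⁻ (inj₂ (here refl))

  module Canonical (i : Fin h) (Γ : List (Fm h)) (con : Consistent Γ) where

    canonical : AFModel CS (Fin 1)
    canonical = record
      { R            = λ _ _ _ → ⊤
      ; R-refl       = λ _ _ → tt
      ; R-trans      = λ _ _ _ → tt
      ; ν            = λ p _ → Γ ⊢ atom p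
      ; Ev           = λ _ t A → Γ ⊢ jst t A
      ; monotone     = λ _ _ _ _ e → e
      ; constSpec    = λ _ _ _ cs → ⊢-lift (nec cs)
      ; application  = λ _ st t u A B e₁ e₂ → ⊢-mp (⊢-axiom (ax2 st t u A B) e₁) e₂
      ; sumˡ         = λ _ st t u A → ⊢-axiom (ax3l st u t A)
      ; sumʳ         = λ _ st t u A → ⊢-axiom (ax3r st u t A)
      ; inspection   = λ _ t A → ⊢-axiom (ax5 t A)
      ; tupling      = λ _ ts A es → ⊢-axiom (ax6 ts A) (⊢-bigAnd ts es)
      ; projection   = λ _ j t A → ⊢-axiom (ax7 j t A)
      ; coclosure-hd = λ _ t A → ⊢-axiom (ax8hd t A)
      ; coclosure-tl = λ _ t A → ⊢-axiom (ax8tl t A)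
      ; induction    = λ _ t u A e₁ e₂ →
                         ⊢-axiom (ax9 t u A) (⊢-∧-intro (⊢-factive i e₁) e₂)
      }

    open AFModel canonical using (_⊩_)

    DecidesAll : List (Fm h) → Set
    DecidesAll Ps = ∀ {P} → P ∈ Ps → P ∈ Γ ⊎ neg P ∈ Γ

    Decided : Fm h → Set
    Decided X = DecidesAll (subformulas X)

    decided-immediate : DecidesAll (Y ∷ subformulas X) → Decided X
    decided-immediate d m = d (there m)

    decidedˡ : ∀ X Y → DecidesAll (P ∷ subformulas X ++ subformulas Y) → Decided X
    decidedˡ X Y d m = d (there (∈-++⁺ˡ m))

    decidedʳ : ∀ X Y → DecidesAll (P ∷ subformulas X ++ subformulas Y) → Decided Y
    decidedʳ X Y d m = d (there (∈-++⁺ʳ (subformulas X) m))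

    decide : ∀ X → Decided X → (Γ ⊢ X) ⊎ (Γ ⊢ neg X)
    decide X d = Sum.map ⊢-member ⊢-member (d (∈-subformulas X))

    ⊩⇒⊢ : ∀ X → Decided X → zero ⊩ X → Γ ⊢ X
    ⊢⇒⊩ : ∀ X → Decided X → Γ ⊢ X → zero ⊩ X

    ⊩⇒⊢ (atom p) _ x = x
    ⊩⇒⊢ (neg X) d ¬x with decide X (decided-immediate d)
    ... | inj₁ ⊢x  = ⊥-elim (¬x (⊢⇒⊩ X (decided-immediate d) ⊢x))
    ... | inj₂ ⊢¬x = ⊢¬x
    ⊩⇒⊢ (X ∧' Y) d (x , y) =
      ⊢-∧-intro (⊩⇒⊢ X (decidedˡ X Y d) x) (⊩⇒⊢ Y (decidedʳ X Y d) y)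
    ⊩⇒⊢ (X ∨' Y) d (inj₁ x) = ⊢-∨-introˡ (⊩⇒⊢ X (decidedˡ X Y d) x)
    ⊩⇒⊢ (X ∨' Y) d (inj₂ y) = ⊢-∨-introʳ (⊩⇒⊢ Y (decidedʳ X Y d) y)
    ⊩⇒⊢ (X ⇒ Y) d f with decide X (decidedˡ X Y d)
    ... | inj₁ ⊢x  =
      ⊢-⇒-weaken (⊩⇒⊢ Y (decidedʳ X Y d) (f (⊢⇒⊩ X (decidedˡ X Y d) ⊢x)))
    ... | inj₂ ⊢¬x = ⊢-⇒-vacuous ⊢¬x
    ⊩⇒⊢ (jst t X) _ (e , _) = e

    ⊢⇒⊩ (atom p) _ ⊢x = ⊢x
    ⊢⇒⊩ (neg X) d ⊢¬x x = con (⊢-contradiction (⊩⇒⊢ X (decided-immediate d) x) ⊢¬x)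
    ⊢⇒⊩ (X ∧' Y) d ⊢xy =
      ⊢⇒⊩ X (decidedˡ X Y d) (⊢-∧-elimˡ ⊢xy) , ⊢⇒⊩ Y (decidedʳ X Y d) (⊢-∧-elimʳ ⊢xy)
    ⊢⇒⊩ (X ∨' Y) d ⊢xy with decide X (decidedˡ X Y d)
    ... | inj₁ ⊢x  = inj₁ (⊢⇒⊩ X (decidedˡ X Y d) ⊢x)
    ... | inj₂ ⊢¬x =
      inj₂ (⊢⇒⊩ Y (decidedʳ X Y d) (⊢-disjunctive-syllogism ⊢xy ⊢¬x))
    ⊢⇒⊩ (X ⇒ Y) d ⊢xy x =
      ⊢⇒⊩ Y (decidedʳ X Y d) (⊢-mp ⊢xy (⊩⇒⊢ X (decidedˡ X Y d) x))
    ⊢⇒⊩ (jst t X) d ⊢tx =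
      ⊢tx , λ { zero _ → ⊢⇒⊩ X (decided-immediate d) (⊢-factive i ⊢tx) }

corollary2 : ExcludedMiddle 0ℓ →
    (h : ℕ) → 1 ≤ h →
    (CS : ConstSpec h) → IsConstSpec CS →
    (A : Fm h) → ¬ Prf CS A →
    Σ ℕ λ n → Σ (AFModel CS (Fin n)) λ M → Σ (Fin n) λ w →
    ¬ (AFModel._⊩_ M w A)
corollary2 em (suc _) (s≤s z≤n) CS _ A ⊬A =
  1 , canonical , zero , ⊢⇒⊩ (neg A) decides (⊢-member (extends (here refl)))
  where
  open Derivations CS
  Δ⁺ : Completion (neg A ∷ []) (subformulas (neg A))
  Δ⁺ = completion em (consistent-neg ⊬A) (subformulas (neg A))
  open Completion Δ⁺
  open Canonical zero Δ consistent
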